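{- Let $G=(V,E)$ be a finite undirected graph and let $B$ be a positive integer with $B\le |V|$. If there exists a burning sequence of length $B$ for $G$, then the integer program GBP-IP$(G,B)$ defined below is feasible.
   Context: For vertices $u,v$ of $G$, $d(u,v)$ denotes the number of edges of a shortest $u$–$v$ path in $G$ ($\infty$ if none exists). For $u\in V$ and integer $j\ge 0$, $N_j[u]=\{v\in V : d(u,v)\le j\}$. A sequence $(v_1,\dots,v_k)\in V^k$ (repetitions allowed) is a burning sequence for $G$ of length $k$ if $\bigcup_{i=1}^{k} N_{k-i}[v_i]=V$. The integer program GBP-IP$(G,B)$, for a positive integer $B\le |V|$, has binary variables $x_{v,i}\in\{0,1\}$ for $v\in V$, $i\in\{1,\dots,B\}$, no objective (feasibility problem), and constraints: (i) $\sum_{i=1}^{B} x_{v,i}\le 1$ for all $v\in V$; (ii) $\sum_{v\in V} x_{v,i}=1$ for all $i\in\{1,\dots,B\}$; (iii) $\sum_{i=1}^{B}\sum_{u\in V:\ v\in N_{B-i}[u]} x_{u,i}\ge 1$ for all $v\in V$. The program is feasible if some $0/1$ assignment to the variables satisfies (i)–(iii). -}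

module Defs where

open import Data.Nat using (ℕ; zero; suc; _+_; _∸_; _≤_)
open import Data.Bool using (Bool; true; false; _∧_; _∨_; if_then_else_)
open import Data.Fin using (Fin; toℕ)
open import Data.Fin.Properties using (_≟_)
open import Data.List using (List; map; allFin)
open import Data.Bool.ListAction using (any)
open import Data.Nat.ListAction using (sum)
open import Data.Product using (Σ; ∃; _×_)
open import Relation.Nullary.Decidable using (⌊_⌋)
open import Relation.Binary.PropositionalEquality using (_≡_)

record Graph (n : ℕ) : Set where
  field
    adj   : Fin n → Fin n → Bool
    sym   : ∀ u v → adj u v ≡ adj v u
    irrefl : ∀ u → adj u u ≡ false

open Graph public

-- inBall G j u v = true  iff  d(u,v) ≤ j  iff  v ∈ N_j[u]
-- (vertices reachable from u by a walk of at most j edges).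
inBall : ∀ {n} → Graph n → ℕ → Fin n → Fin n → Bool
inBall G zero    u v = ⌊ u ≟ v ⌋
inBall G (suc j) u v =
  inBall G j u v ∨ any (λ w → inBall G j u w ∧ adj G w v) (allFin _)

_∈N[_,_,_] : ∀ {n} → Fin n → Graph n → ℕ → Fin n → Set
v ∈N[ G , j , u ] = inBall G j u v ≡ true

∑ : (m : ℕ) → (Fin m → ℕ) → ℕ
∑ m f = sum (map f (allFin m))

-- (v_1,…,v_k), with v_{i+1} = s i for i : Fin k, is a burning sequence:
-- ⋃_i N_{k-i}[v_i] = V   (1-based index i = toℕ i' + 1).
IsBurningSequence : ∀ {n} → Graph n → (k : ℕ) → (Fin k → Fin n) → Set
IsBurningSequence {n} G k s =
  ∀ (v : Fin n) → ∃ λ (i : Fin k) → v ∈N[ G , k ∸ suc (toℕ i) , s i ]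

-- 0/1 assignment x_{v,i} (column index i : Fin B stands for i+1 ∈ {1..B})
-- satisfying constraints (i)–(iii) of GBP-IP(G,B).
IsGBPSolution : ∀ {n} → Graph n → (B : ℕ) → (Fin n → Fin B → ℕ) → Set
IsGBPSolution {n} G B x =
  (∀ v i → x v i ≤ 1)
  × (∀ v → ∑ B (λ i → x v i) ≤ 1)
  × (∀ i → ∑ n (λ v → x v i) ≡ 1)
  × (∀ v → 1 ≤ ∑ B (λ i → ∑ n (λ u →
        if inBall G (B ∸ suc (toℕ i)) u v then x u i else 0)))

GBP-IP-Feasible : ∀ {n} → Graph n → ℕ → Set
GBP-IP-Feasible {n} G B = Σ (Fin n → Fin B → ℕ) (IsGBPSolution G B)

-- A burning sequence may repeat a vertex, while the integer program places each vertex at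
-- most once.  A repeated entry is redundant: its ball is contained in the larger ball of the
-- earlier occurrence of the same vertex.  Since B ≤ |V|, repeated entries can therefore be
-- replaced by fresh vertices, giving a burning sequence without repetitions, and its
-- indicator matrix x_{v,i} = [t_i = v] solves GBP-IP(G,B).
module Submission where

open import Defs hiding (sym)
open import Data.Nat using (ℕ; zero; suc; _+_; _∸_; _≤_; _<_; z≤n; s≤s; _≤′_; ≤′-refl; ≤′-step)
open import Data.Nat.Properties
  using (≤⇒≤′; ≤-trans; ≤-reflexive; <⇒≤; +-identityʳ; m≤m+n; m≤n+m; module ≤-Reasoning)
open import Data.Nat.ListAction using (sum)
open import Data.Fin as Fin using (Fin; toℕ; opposite)
open import Data.Fin.Properties
  using (_≟_; any?; ¬∀⟶∃¬; <⇒notInjective; suc-injective; opposite-prop; opposite-involutive)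
open import Data.Vec.Functional using (_∷_; tail)
open import Data.List.Properties using (map-tabulate)
open import Data.Bool using (true; false; if_then_else_)
open import Data.Product using (∃; _×_; _,_; proj₁; proj₂)
open import Data.Sum using (_⊎_; inj₁; inj₂)
open import Data.Empty using (⊥-elim)
open import Function using (_∘_)
open import Function.Definitions using (Injective)
open import Relation.Nullary using (¬_; yes; no)
open import Relation.Nullary.Decidable using (⌊_⌋)
open import Relation.Binary.PropositionalEquality
  using (_≡_; _≢_; refl; sym; trans; cong; cong₂; subst; module ≡-Reasoning)

∑-suc : ∀ m (f : Fin (suc m) → ℕ) → ∑ (suc m) f ≡ f Fin.zero + ∑ m (f ∘ Fin.suc)
∑-suc m f = cong (λ fs → f Fin.zero + sum fs)
  (trans (map-tabulate Fin.suc f) (sym (map-tabulate (λ i → i) (f ∘ Fin.suc))))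

∑-vanishing : ∀ m (f : Fin m → ℕ) → (∀ i → f i ≡ 0) → ∑ m f ≡ 0
∑-vanishing zero    f f≡0 = refl
∑-vanishing (suc m) f f≡0 =
  trans (∑-suc m f) (cong₂ _+_ (f≡0 Fin.zero) (∑-vanishing m _ (f≡0 ∘ Fin.suc)))

∑-concentrated : ∀ m (f : Fin m → ℕ) a → (∀ i → i ≢ a → f i ≡ 0) → ∑ m f ≡ f a
∑-concentrated (suc m) f Fin.zero off-a = begin
  ∑ (suc m) f                       ≡⟨ ∑-suc m f ⟩
  f Fin.zero + ∑ m (f ∘ Fin.suc)    ≡⟨ cong (f Fin.zero +_) (∑-vanishing m _ (λ i → off-a (Fin.suc i) λ ())) ⟩
  f Fin.zero + 0                    ≡⟨ +-identityʳ _ ⟩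
  f Fin.zero                        ∎
  where open ≡-Reasoning
∑-concentrated (suc m) f (Fin.suc a) off-a = begin
  ∑ (suc m) f                       ≡⟨ ∑-suc m f ⟩
  f Fin.zero + ∑ m (f ∘ Fin.suc)    ≡⟨ cong (_+ ∑ m (f ∘ Fin.suc)) (off-a Fin.zero λ ()) ⟩
  ∑ m (f ∘ Fin.suc)                 ≡⟨ ∑-concentrated m _ a (λ i i≢a → off-a (Fin.suc i) (i≢a ∘ suc-injective)) ⟩
  f (Fin.suc a)                     ∎
  where open ≡-Reasoning

term≤∑ : ∀ m (f : Fin m → ℕ) i → f i ≤ ∑ m f
term≤∑ (suc m) f Fin.zero    rewrite ∑-suc m f = m≤m+n _ _
term≤∑ (suc m) f (Fin.suc i) rewrite ∑-suc m f = ≤-trans (term≤∑ m _ i) (m≤n+m _ _)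

∃-∉-image : ∀ {m n} → m < n → (f : Fin m → Fin n) → ∃ λ w → ∀ i → f i ≢ w
∃-∉-image {n = n} m<n f =
  let w , w∉f = ¬∀⟶∃¬ n (λ w → ∃ λ i → f i ≡ w) (λ w → any? (λ i → f i ≟ w)) f-not-onto
  in  w , λ i fi≡w → w∉f (i , fi≡w)
  where
  f-not-onto : ¬ (∀ w → ∃ λ i → f i ≡ w)
  f-not-onto onto = <⇒notInjective m<n section-injective
    where
    section-injective : Injective _≡_ _≡_ (proj₁ ∘ onto)
    section-injective {w} {w′} eq = trans (sym (proj₂ (onto w))) (trans (cong f eq) (proj₂ (onto w′)))

fresh-head : ∀ {m n} → m < n → (t : Fin m → Fin n) (a : Fin n) →
  ∃ λ w → (∀ i → t i ≢ w) × (w ≡ a ⊎ ∃ λ i → t i ≡ a)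
fresh-head m<n t a with any? (λ i → t i ≟ a)
... | yes a∈t = let w , w∉t = ∃-∉-image m<n t in w , w∉t , inj₂ a∈t
... | no  a∉t = a , (λ i ti≡a → a∉t (i , ti≡a)) , inj₁ refl

injective-resequencing : ∀ {m n} → m ≤ n → (s : Fin m → Fin n) →
  ∃ λ t → Injective _≡_ _≡_ t × ∀ i → ∃ λ (j : Fin m) → i Fin.≤ j × t j ≡ s i
injective-resequencing {zero}  _   s = (λ ()) , (λ { {()} }) , λ ()
injective-resequencing {suc m} m<n s
  with t , t-inj , t-resequences ← injective-resequencing (<⇒≤ m<n) (tail s)
  with w , w∉t , w-ok ← fresh-head m<n t (s Fin.zero)
  = w ∷ t , w∷t-inj , w∷t-resequences
  where
  w∷t-inj : Injective _≡_ _≡_ (w ∷ t)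
  w∷t-inj {Fin.zero}  {Fin.zero}  _ = refl
  w∷t-inj {Fin.zero}  {Fin.suc j} e = ⊥-elim (w∉t j (sym e))
  w∷t-inj {Fin.suc i} {Fin.zero}  e = ⊥-elim (w∉t i e)
  w∷t-inj {Fin.suc i} {Fin.suc j} e = cong Fin.suc (t-inj e)
  w∷t-resequences : ∀ i → ∃ λ (j : Fin (suc m)) → i Fin.≤ j × (w ∷ t) j ≡ s i
  w∷t-resequences Fin.zero = head-occurrence w-ok
    where
    head-occurrence : w ≡ s Fin.zero ⊎ (∃ λ j → t j ≡ s Fin.zero) →
      ∃ λ (j : Fin (suc m)) → Fin.zero {m} Fin.≤ j × (w ∷ t) j ≡ s Fin.zero
    head-occurrence (inj₁ w≡s₀)        = Fin.zero , z≤n , w≡s₀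
    head-occurrence (inj₂ (j , tj≡s₀)) = Fin.suc j , z≤n , tj≡s₀
  w∷t-resequences (Fin.suc i) with j , i≤j , tj≡si ← t-resequences i = Fin.suc j , s≤s i≤j , tj≡si

opposite-injective : ∀ {m} → Injective _≡_ _≡_ (opposite {m})
opposite-injective {x = i} {j} eq =
  trans (sym (opposite-involutive i)) (trans (cong opposite eq) (opposite-involutive j))

module _ {n : ℕ} (G : Graph n) where

  inBall-mono : ∀ {j k u v} → j ≤ k → v ∈N[ G , j , u ] → v ∈N[ G , k , u ]
  inBall-mono j≤k = mono′ (≤⇒≤′ j≤k)
    where
    mono′ : ∀ {j k u v} → j ≤′ k → v ∈N[ G , j , u ] → v ∈N[ G , k , u ]
    mono′ ≤′-refl          v∈ = v∈
    mono′ (≤′-step j≤′k) v∈ rewrite mono′ j≤′k v∈ = refl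

  CoveredByBalls : ∀ {m} → (Fin m → ℕ) → (Fin m → Fin n) → Set
  CoveredByBalls r c = ∀ v → ∃ λ i → v ∈N[ G , r i , c i ]

  covered-by-larger-copies : ∀ {m} {r : Fin m → ℕ} {c c′ : Fin m → Fin n} → CoveredByBalls r c →
    (∀ i → ∃ λ j → r i ≤ r j × c′ j ≡ c i) → CoveredByBalls r c′
  covered-by-larger-copies {r = r} {c} {c′} covered copies v
    with i , v∈ ← covered v
    with j , ri≤rj , c′j≡ci ← copies i
    = j , subst (λ u → v ∈N[ G , r j , u ]) (sym c′j≡ci) (inBall-mono ri≤rj v∈)

  -- The resequencing is applied to the reversed sequence, where radii increase with the index.
  injective-burning-sequence : ∀ {B} → B ≤ n → (s : Fin B → Fin n) → IsBurningSequence G B s →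
    ∃ λ t → Injective _≡_ _≡_ t × IsBurningSequence G B t
  injective-burning-sequence {B} B≤n s burns
    with t , t-inj , t-resequences ← injective-resequencing B≤n (s ∘ opposite)
    = t ∘ opposite , opposite-injective ∘ t-inj , covered-by-larger-copies burns larger-copy
    where
    larger-copy : ∀ i → ∃ λ j → B ∸ suc (toℕ i) ≤ B ∸ suc (toℕ j) × t (opposite j) ≡ s i
    larger-copy i with j , ī≤j , tj≡sī ← t-resequences (opposite i) =
      opposite j , radius-≤ , trans (cong t (opposite-involutive j)) (trans tj≡sī (cong s (opposite-involutive i)))
      where
      open ≤-Reasoning
      radius-≤ : B ∸ suc (toℕ i) ≤ B ∸ suc (toℕ (opposite j))
      radius-≤ = begin
        B ∸ suc (toℕ i)              ≡⟨ opposite-prop i ⟨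
        toℕ (opposite i)             ≤⟨ ī≤j ⟩
        toℕ j                        ≡⟨ cong toℕ (opposite-involutive j) ⟨
        toℕ (opposite (opposite j))  ≡⟨ opposite-prop (opposite j) ⟩
        B ∸ suc (toℕ (opposite j))   ∎

δ : ∀ {n} → Fin n → Fin n → ℕ
δ a b = if ⌊ a ≟ b ⌋ then 1 else 0

δ-≤1 : ∀ {n} (a b : Fin n) → δ a b ≤ 1
δ-≤1 a b with ⌊ a ≟ b ⌋
... | true  = s≤s z≤n
... | false = z≤n

δ-refl : ∀ {n} (a : Fin n) → δ a a ≡ 1
δ-refl a with a ≟ a
... | yes _   = refl
... | no a≢a = ⊥-elim (a≢a refl)

δ-≢ : ∀ {n} {a b : Fin n} → a ≢ b → δ a b ≡ 0
δ-≢ {a = a} {b} a≢b with a ≟ b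
... | yes a≡b = ⊥-elim (a≢b a≡b)
... | no _    = refl

∑-δ : ∀ {n} (a : Fin n) → ∑ n (δ a) ≡ 1
∑-δ a = trans (∑-concentrated _ (δ a) a (λ b b≢a → δ-≢ (b≢a ∘ sym))) (δ-refl a)

∑-δ-injective : ∀ {m n} {t : Fin m → Fin n} → Injective _≡_ _≡_ t → ∀ v → ∑ m (λ i → δ (t i) v) ≤ 1
∑-δ-injective {m} {t = t} t-inj v with any? (λ i → t i ≟ v)
... | yes (i , refl) =
  ≤-trans (≤-reflexive (∑-concentrated m _ i (λ j j≢i → δ-≢ (j≢i ∘ t-inj)))) (δ-≤1 (t i) (t i))
... | no v∉t =
  ≤-trans (≤-reflexive (∑-vanishing m _ (λ i → δ-≢ (λ ti≡v → v∉t (i , ti≡v))))) z≤n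

indicator-solution : ∀ {n B} (G : Graph n) {t : Fin B → Fin n} → Injective _≡_ _≡_ t →
  IsBurningSequence G B t → IsGBPSolution G B (λ u i → δ (t i) u)
indicator-solution {n} {B} G {t} t-inj burns =
  (λ u i → δ-≤1 (t i) u) , ∑-δ-injective t-inj , (λ i → ∑-δ (t i)) , covered
  where
  ball-term : Fin B → Fin n → Fin n → ℕ
  ball-term i v u = if inBall G (B ∸ suc (toℕ i)) u v then δ (t i) u else 0
  covered : ∀ v → 1 ≤ ∑ B (λ i → ∑ n (ball-term i v))
  covered v with i , v∈ ← burns v = begin
    1                           ≡⟨ δ-refl (t i) ⟨
    δ (t i) (t i)               ≡⟨ cong (λ b → if b then δ (t i) (t i) else 0) v∈ ⟨
    ball-term i v (t i)         ≤⟨ term≤∑ n (ball-term i v) (t i) ⟩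
    ∑ n (ball-term i v)         ≤⟨ term≤∑ B (λ i → ∑ n (ball-term i v)) i ⟩
    ∑ B (λ i → ∑ n (ball-term i v)) ∎
    where open ≤-Reasoning

proposition2 : ∀ {n : ℕ} (G : Graph n) (B : ℕ) → 0 < B → B ≤ n →
    (∃ λ (s : Fin B → Fin n) → IsBurningSequence G B s) →
    GBP-IP-Feasible G B
proposition2 G B _ B≤n (s , burns) =
  let t , t-inj , t-burns = injective-burning-sequence G B≤n s burns
  in  (λ u i → δ (t i) u) , indicator-solution G t-inj t-burns
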